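{- Let $\mathcal{C} = \{c_{1}, \ldots, c_{n} \}$ be a finite coin set with $c_1<c_2<\cdots<c_n$. The following are equivalent: (i) $\mathcal{C}$ is completely greedy; (ii) every sub-coin set of $\mathcal{C}$ of cardinality $3$ is greedy; (iii) for all $3\le k\le n$, the set $\{c_{1},c_{k-1},c_{k} \}$ is greedy.
   Context: A coin set is a set of positive integers containing $1$ (so $c_1=1$); a sub-coin set is a subset of a coin set that contains $1$. A representation of a positive integer $m$ in a coin set $\mathcal{C}$ is an expression $m=\sum_{c\in\mathcal{C}}\alpha_c c$ with $\alpha_c\in\mathbb{N}$; it is minimal if the number of coins $\sum_c \alpha_c$ is as small as possible. The greedy representation is obtained by repeatedly subtracting the largest coin not exceeding the remaining amount. A coin set is greedy if for every positive integer the greedy representation is minimal. A coin set is completely greedy if all of its sub-coin sets are greedy. -}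

module Defs where

open import Data.Nat using (ℕ; zero; suc; _+_; _≤_; _<_; _≤?_; _⊔_)
open import Data.Nat.Properties using ()
open import Data.List using (List; []; _∷_; length)
open import Data.Nat.ListAction using (sum)
open import Data.List.Membership.Propositional using (_∈_)
open import Data.List.Relation.Unary.All using (All)
open import Data.Maybe using (Maybe; just; nothing)
open import Relation.Nullary using (yes; no)
open import Relation.Binary.PropositionalEquality using (_≡_)

CoinSet : List ℕ → Set
CoinSet S = (1 ∈ S) × All (λ c → 1 ≤ c) S
  where open import Data.Product using (_×_)

largestBelow : List ℕ → ℕ → Maybe ℕ
largestBelow [] r = nothing
largestBelow (c ∷ cs) r with largestBelow cs r | c ≤? r
... | nothing | yes _ = just c
... | nothing | no _  = nothing
... | just d  | yes _ = just (c ⊔ d)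
... | just d  | no _  = just d

-- greedy algorithm: repeatedly subtract the largest coin not exceeding the
-- remaining amount; returns the list of coins used.  Fuel = amount suffices
-- since every coin is ≥ 1.
greedyFuel : List ℕ → ℕ → ℕ → List ℕ
greedyFuel S zero r = []
greedyFuel S (suc f) zero = []
greedyFuel S (suc f) (suc r) with largestBelow S (suc r)
... | nothing = []
... | just c  = c ∷ greedyFuel S f (suc r Data.Nat.∸ c)

greedyRep : List ℕ → ℕ → List ℕ
greedyRep S m = greedyFuel S m m

-- A representation of m in S is a multiset of coins of S (as a list) summing
-- to m; its number of coins is its length.
IsRep : List ℕ → ℕ → List ℕ → Set
IsRep S m ys = All (_∈ S) ys × sum ys ≡ m
  where open import Data.Product using (_×_)

Greedy : List ℕ → Set
Greedy S = ∀ m → 1 ≤ m → ∀ ys → IsRep S m ys → length (greedyRep S m) ≤ length ys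

SubCoinSet : List ℕ → List ℕ → Set
SubCoinSet S C = (∀ {x} → x ∈ S → x ∈ C) × (1 ∈ S)
  where open import Data.Product using (_×_)

CompletelyGreedy : List ℕ → Set
CompletelyGreedy C = ∀ S → SubCoinSet S C → Greedy S

-- c_k for 1-indexed k (0 when out of range)
coinAt : List ℕ → ℕ → ℕ
coinAt [] k = 0
coinAt (c ∷ cs) zero = 0
coinAt (c ∷ cs) (suc zero) = c
coinAt (c ∷ cs) (suc (suc k)) = coinAt cs (suc k)

-- Call b exchangeable over a when some multiple s·a exceeds b by t < s, so that s coins a can
-- be traded for one coin b and t coins 1.  Greediness of {1, a, b} forces this (test the amount
-- (⌊b/a⌋+1)·a), and the relation is transitive.  Conversely, if all pairs of coins are
-- exchangeable the set is greedy: given a representation of m avoiding the greedy coin g, it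
-- uses only coins below g, which form a greedy set by induction; rewriting it greedily as k
-- coins a (the largest one) plus a remainder and trading s of them for g, or paying m − g in
-- ones when k < s, yields a shorter representation of m − g.
module Submission where

open import Defs
open import Data.Nat
open import Data.Nat.Properties
open import Data.Nat.DivMod using (_/_; _%_; m≡m%n+[m/n]*n; m%n<n)
open import Data.Nat.Induction using (<-rec)
open import Data.Nat.ListAction using (sum)
open import Data.Nat.ListAction.Properties using (sum-↭)
open import Data.Nat.Tactic.RingSolver using (solve-∀)
open import Data.List using (List; []; _∷_; length; replicate; _++_; filter)
open import Data.List.Properties using (length-++; length-replicate)
open import Data.List.Membership.Propositional using (_∈_; _∉_)
open import Data.List.Membership.Propositional.Properties using (∈-∃++; ∈-filter⁺; ∈-filter⁻)
open import Data.List.Membership.DecPropositional _≟_ using (_∈?_)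
open import Data.List.Relation.Unary.Any using (here; there)
open import Data.List.Relation.Unary.All as All using (All; []; _∷_)
open import Data.List.Relation.Unary.All.Properties using (++⁺; replicate⁺; filter⁺)
open import Data.List.Relation.Unary.AllPairs using (AllPairs; []; _∷_)
open import Data.List.Relation.Unary.Linked as Linked using (Linked; []; [-]; _∷_)
open import Data.List.Relation.Unary.Linked.Properties using (Linked⇒All; Linked⇒AllPairs)
open import Data.List.Relation.Binary.Permutation.Propositional using (_↭_)
open import Data.List.Relation.Binary.Permutation.Propositional.Properties
  using (shift; ↭-length; All-resp-↭)
open import Data.Maybe using (just; nothing)
open import Data.Product using (∃; ∃₂; _×_; _,_; proj₁; proj₂; map₁; map₂)
open import Data.Sum using (inj₁; inj₂)
open import Function.Base using (_∘_)
open import Function.Bundles using (_⇔_; mk⇔)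
open import Relation.Nullary using (¬_; yes; no; contradiction)
open import Relation.Binary.PropositionalEquality

sum-replicate : ∀ n x → sum (replicate n x) ≡ n * x
sum-replicate zero    x = refl
sum-replicate (suc n) x = cong (x +_) (sum-replicate n x)

sum-ones++copies : ∀ t d {a} zs →
  sum (replicate t 1 ++ replicate d a ++ zs) ≡ t + (d * a + sum zs)
sum-ones++copies (suc t) d     zs = cong suc (sum-ones++copies t d zs)
sum-ones++copies zero    zero  zs = refl
sum-ones++copies zero (suc d) {a} zs =
  trans (cong (a +_) (sum-ones++copies zero d zs)) (sym (+-assoc a (d * a) (sum zs)))

length-replicate++replicate++ : ∀ {A : Set} t d {x y : A} zs →
  length (replicate t x ++ replicate d y ++ zs) ≡ t + (d + length zs)
length-replicate++replicate++ (suc t) d       {x} {y} zs =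
  cong suc (length-replicate++replicate++ t d {x} {y} zs)
length-replicate++replicate++ zero    (suc d) {x} {y} zs =
  cong suc (length-replicate++replicate++ zero d {x} {y} zs)
length-replicate++replicate++ zero    zero            zs = refl

∈⇒≤sum : ∀ {x xs} → x ∈ xs → x ≤ sum xs
∈⇒≤sum {xs = y ∷ ys} (here refl) = m≤m+n y (sum ys)
∈⇒≤sum {xs = y ∷ ys} (there x∈ys) = ≤-trans (∈⇒≤sum x∈ys) (m≤n+m (sum ys) y)

m+n≡o⇒n≡o∸m : ∀ {m n o} → m + n ≡ o → n ≡ o ∸ m
m+n≡o⇒n≡o∸m {m} {n} refl = sym (m+n∸m≡n m n)

∈⇒↭∷ : ∀ {x : ℕ} {xs} → x ∈ xs → ∃ λ rest → xs ↭ x ∷ rest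
∈⇒↭∷ x∈xs with ∈-∃++ x∈xs
... | ws , zs , refl = ws ++ zs , shift _ ws zs

division : ∀ m a → 1 ≤ a → ∃₂ λ k ρ → m ≡ k * a + ρ × ρ < a
division m a@(suc _) _ =
  m / a , m % a , trans (m≡m%n+[m/n]*n m a) (+-comm (m % a) _) , m%n<n m a

IsLargestBelow : List ℕ → ℕ → ℕ → Set
IsLargestBelow S r g = g ∈ S × g ≤ r × (∀ {c} → c ∈ S → c ≤ r → c ≤ g)

largestBelow≡nothing : ∀ S r → largestBelow S r ≡ nothing → ∀ {c} → c ∈ S → ¬ c ≤ r
largestBelow≡nothing (c ∷ cs) r eq c∈S c≤r with largestBelow cs r in e | c ≤? r
largestBelow≡nothing (c ∷ cs) r () _ _ | nothing | yes _
largestBelow≡nothing (c ∷ cs) r _ (here refl) c≤r | nothing | no c≰r = c≰r c≤r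
largestBelow≡nothing (c ∷ cs) r _ (there c∈cs) c≤r | nothing | no _ =
  largestBelow≡nothing cs r e c∈cs c≤r

largestBelow≡just : ∀ S r {g} → largestBelow S r ≡ just g → IsLargestBelow S r g
largestBelow≡just (c ∷ cs) r eq with largestBelow cs r in e | c ≤? r
largestBelow≡just (c ∷ cs) r refl | nothing | yes c≤r = here refl , c≤r , largest
  where
  largest : ∀ {x} → x ∈ c ∷ cs → x ≤ r → x ≤ c
  largest (here refl) _  = ≤-refl
  largest (there x∈cs) x≤r = contradiction x≤r (largestBelow≡nothing cs r e x∈cs)
largestBelow≡just (c ∷ cs) r refl | just d | yes c≤r with largestBelow≡just cs r e
... | d∈cs , d≤r , d-largest = c⊔d∈ , ⊔-lub c≤r d≤r , largest
  where
  c⊔d∈ : c ⊔ d ∈ c ∷ cs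
  c⊔d∈ with ⊔-sel c d
  ... | inj₁ c⊔d≡c = here c⊔d≡c
  ... | inj₂ c⊔d≡d = there (subst (_∈ cs) (sym c⊔d≡d) d∈cs)
  largest : ∀ {x} → x ∈ c ∷ cs → x ≤ r → x ≤ c ⊔ d
  largest (here refl) _  = m≤m⊔n c d
  largest (there x∈cs) x≤r = ≤-trans (d-largest x∈cs x≤r) (m≤n⊔m c d)
largestBelow≡just (c ∷ cs) r refl | just d | no c≰r with largestBelow≡just cs r e
... | d∈cs , d≤r , d-largest = there d∈cs , d≤r , largest
  where
  largest : ∀ {x} → x ∈ c ∷ cs → x ≤ r → x ≤ d
  largest (here refl) c≤r  = contradiction c≤r c≰r
  largest (there x∈cs) x≤r = d-largest x∈cs x≤r

largest-unique : ∀ {S r g h} → IsLargestBelow S r g → IsLargestBelow S r h → g ≡ h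
largest-unique (g∈S , g≤r , g-largest) (h∈S , h≤r , h-largest) =
  ≤-antisym (h-largest g∈S g≤r) (g-largest h∈S h≤r)

largestBelow-complete : ∀ S r {g} → IsLargestBelow S r g → largestBelow S r ≡ just g
largestBelow-complete S r lg@(g∈S , g≤r , _) with largestBelow S r in e
... | nothing = contradiction g≤r (largestBelow≡nothing S r e g∈S)
... | just h  = cong just (largest-unique (largestBelow≡just S r e) lg)

largest-exists : ∀ S r → 1 ∈ S → 1 ≤ r → ∃ (IsLargestBelow S r)
largest-exists S r 1∈S 1≤r with largestBelow S r in e
... | nothing = contradiction 1≤r (largestBelow≡nothing S r e 1∈S)
... | just g  = g , largestBelow≡just S r e

module _ {S : List ℕ} (pos : All (1 ≤_) S) where

  remainder<amount : ∀ {m g} → IsLargestBelow S m g → m ∸ g < m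
  remainder<amount (g∈S , g≤m , _) = ∸-monoʳ-< (All.lookup pos g∈S) g≤m

  greedyFuel-irrelevant : ∀ f f′ r → r ≤ f → r ≤ f′ → greedyFuel S f r ≡ greedyFuel S f′ r
  greedyFuel-irrelevant zero    zero     r       _         _          = refl
  greedyFuel-irrelevant zero    (suc _)  zero    _         _          = refl
  greedyFuel-irrelevant (suc _) zero     zero    _         _          = refl
  greedyFuel-irrelevant (suc _) (suc _)  zero    _         _          = refl
  greedyFuel-irrelevant (suc f) (suc f′) (suc r) (s≤s r≤f) (s≤s r≤f′)
    with largestBelow S (suc r) in e
  ... | nothing = refl
  ... | just g  = cong (g ∷_) (greedyFuel-irrelevant f f′ (suc r ∸ g)
                    (≤-trans rest≤r r≤f) (≤-trans rest≤r r≤f′))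
    where
    rest≤r : suc r ∸ g ≤ r
    rest≤r = <⇒≤pred (remainder<amount (largestBelow≡just S (suc r) e))

  greedyRep-largest : ∀ {m g} → IsLargestBelow S m g → greedyRep S m ≡ g ∷ greedyRep S (m ∸ g)
  greedyRep-largest {zero} lg = contradiction (remainder<amount lg) n≮0
  greedyRep-largest {suc r} {g} lg rewrite largestBelow-complete S (suc r) lg =
    cong (g ∷_) (greedyFuel-irrelevant r (suc r ∸ g) (suc r ∸ g)
      (<⇒≤pred (remainder<amount lg)) ≤-refl)

  greedyRep-isRep : 1 ∈ S → ∀ m → IsRep S m (greedyRep S m)
  greedyRep-isRep 1∈S = <-rec (λ m → IsRep S m (greedyRep S m)) isRep
    where
    isRep : ∀ m → (∀ {k} → k < m → IsRep S k (greedyRep S k)) → IsRep S m (greedyRep S m)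
    isRep zero    _  = [] , refl
    isRep (suc r) ih with largest-exists S (suc r) 1∈S (s≤s z≤n)
    ... | g , lg@(g∈S , g≤m , _) rewrite greedyRep-largest lg
      with ih (remainder<amount lg)
    ... | coins∈S , sum≡ = g∈S ∷ coins∈S , trans (cong (g +_) sum≡) (m+[n∸m]≡n g≤m)

Shortenable : List ℕ → ℕ → ℕ → Set
Shortenable S m g = ∀ ys → IsRep S m ys → ∃ λ zs → IsRep S (m ∸ g) zs × length zs < length ys

greedy-by-shortening : ∀ {S} → All (1 ≤_) S → 1 ∈ S →
  (∀ {m g} → IsLargestBelow S m g → Shortenable S m g) → Greedy S
greedy-by-shortening {S} pos 1∈S shorten m _ = <-rec Optimal optimal m
  where
  Optimal : ℕ → Set
  Optimal m = ∀ ys → IsRep S m ys → length (greedyRep S m) ≤ length ys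
  optimal : ∀ m → (∀ {k} → k < m → Optimal k) → Optimal m
  optimal zero    _  _  _   = z≤n
  optimal (suc r) ih ys rep with largest-exists S (suc r) 1∈S (s≤s z≤n)
  ... | g , lg with shorten lg ys rep
  ... | zs , rep′ , shorter rewrite greedyRep-largest pos lg =
    ≤-trans (s≤s (ih (remainder<amount pos lg) zs rep′)) shorter

removing-coin-shortens : ∀ {S m g ys} → g ∈ ys → IsRep S m ys →
  ∃ λ zs → IsRep S (m ∸ g) zs × length zs < length ys
removing-coin-shortens g∈ys (coins∈S , sum≡) with ∈⇒↭∷ g∈ys
... | rest , ys↭ =
  rest ,
  (All.tail (All-resp-↭ ys↭ coins∈S) , m+n≡o⇒n≡o∸m (trans (sym (sum-↭ ys↭)) sum≡)) ,
  ≤-reflexive (sym (↭-length ys↭))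

Exchangeable : ℕ → ℕ → Set
Exchangeable a b = ∃₂ λ s t → t < s × b + t ≡ s * a

exchangeable-one : ∀ {b} → 1 ≤ b → Exchangeable 1 b
exchangeable-one {b} 1≤b = b , 0 , 1≤b , trans (+-identityʳ b) (sym (*-identityʳ b))

-- Trade v·s coins a for v coins b and v·t ones, then the v coins b for one c and u ones.
exchangeable-trans : ∀ {a b c} → Exchangeable a b → Exchangeable b c → Exchangeable a c
exchangeable-trans {a} {b} {c} (s , t , t<s , b+t≡sa) (v , u , u<v , c+u≡vb) =
  v * s , u + v * t , lt , eq
  where
  lt : u + v * t < v * s
  lt = begin-strict
    u + v * t  <⟨ +-monoˡ-< (v * t) u<v ⟩
    v + v * t  ≡⟨ *-suc v t ⟨
    v * suc t  ≤⟨ *-monoʳ-≤ v t<s ⟩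
    v * s      ∎
    where open ≤-Reasoning
  eq : c + (u + v * t) ≡ v * s * a
  eq = begin
    c + (u + v * t)  ≡⟨ +-assoc c u (v * t) ⟨
    c + u + v * t    ≡⟨ cong (_+ v * t) c+u≡vb ⟩
    v * b + v * t    ≡⟨ *-distribˡ-+ v b t ⟨
    v * (b + t)      ≡⟨ cong (v *_) b+t≡sa ⟩
    v * (s * a)      ≡⟨ *-assoc v s a ⟨
    v * s * a        ∎
    where open ≡-Reasoning

greedy-triple⇒exchangeable : ∀ {a b} → 1 ≤ a → a < b → Greedy (1 ∷ a ∷ b ∷ []) → Exchangeable a b
greedy-triple⇒exchangeable {a} {b} 1≤a a<b greedy with division b a 1≤a
... | zero , zero , b≡0 , _ = contradiction b≡0 (>⇒≢ (<-trans 1≤a a<b))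
... | q@(suc _) , zero , b≡qa+0 , _ =
  q , 0 , z<s , trans (+-identityʳ b) (trans b≡qa+0 (+-identityʳ (q * a)))
... | q , suc r , b≡qa+r , r<a = suc q , t , t<s , m+[n∸m]≡n b≤m
  where
  T = 1 ∷ a ∷ b ∷ []
  pos : All (1 ≤_) T
  pos = ≤-refl ∷ 1≤a ∷ ≤-trans 1≤a (<⇒≤ a<b) ∷ []
  m = suc q * a
  t = m ∸ b
  b≤m : b ≤ m
  b≤m = subst₂ _≤_ (sym b≡qa+r) (+-comm (q * a) a) (+-monoʳ-≤ (q * a) (<⇒≤ r<a))
  t<a : t < a
  t<a = +-cancelˡ-< b t a (subst (_< b + a) (sym (m+[n∸m]≡n b≤m)) m<b+a)
    where
    m<b+a : m < b + a
    m<b+a = subst₂ _<_ (+-comm (q * a) a) (cong (_+ a) (sym b≡qa+r))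
              (+-monoˡ-< a (m<m+n (q * a) z<s))
  ones-below-a : ∀ x → x < a → length (greedyRep T x) ≡ x
  ones-below-a zero    _   = refl
  ones-below-a (suc x) x<a = trans (cong length (greedyRep-largest pos one-largest))
                               (cong suc (ones-below-a x (<-trans (n<1+n x) x<a)))
    where
    one-largest : IsLargestBelow T (suc x) 1
    one-largest = here refl , s≤s z≤n , λ
      { (here refl) _ → ≤-refl
      ; (there (here refl)) a≤x → contradiction x<a (≤⇒≯ a≤x)
      ; (there (there (here refl))) b≤x → contradiction (<-trans x<a a<b) (≤⇒≯ b≤x) }
  b-largest : IsLargestBelow T m b
  b-largest = there (there (here refl)) , b≤m , λ
    { (here refl) _ → All.lookup pos (there (there (here refl)))
    ; (there (here refl)) _ → <⇒≤ a<b
    ; (there (there (here refl))) _ → ≤-refl }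
  greedy-length : length (greedyRep T m) ≡ suc t
  greedy-length = trans (cong length (greedyRep-largest pos b-largest)) (cong suc (ones-below-a t t<a))
  t<s : t < suc q
  t<s = subst (_≤ suc q) greedy-length
          (subst (length (greedyRep T m) ≤_) (length-replicate (suc q))
            (greedy m (≤-trans 1≤a (m≤m+n a (q * a))) (replicate (suc q) a)
              (replicate⁺ (suc q) (there (here refl)) , sum-replicate (suc q) a)))

traded-sum : ∀ {a g s t k} ρ → g + t ≡ s * a → s ≤ k → g + (t + ((k ∸ s) * a + ρ)) ≡ k * a + ρ
traded-sum {a} {g} {s} {t} {k} ρ g+t≡sa s≤k = begin
  g + (t + ((k ∸ s) * a + ρ))  ≡⟨ regroup g t ((k ∸ s) * a) ρ ⟩
  g + t + (k ∸ s) * a + ρ      ≡⟨ cong (λ x → x + (k ∸ s) * a + ρ) g+t≡sa ⟩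
  s * a + (k ∸ s) * a + ρ      ≡⟨ cong (_+ ρ) (*-distribʳ-+ a s (k ∸ s)) ⟨
  (s + (k ∸ s)) * a + ρ        ≡⟨ cong (λ x → x * a + ρ) (m+[n∸m]≡n s≤k) ⟩
  k * a + ρ                    ∎
  where
  open ≡-Reasoning
  regroup : ∀ g t x ρ → g + (t + (x + ρ)) ≡ g + t + x + ρ
  regroup = solve-∀

k<s⇒amount<g+k : ∀ {a g s t k ρ} → 1 ≤ a → ρ < a → k < s → t < s → g + t ≡ s * a → k * a + ρ < g + k
k<s⇒amount<g+k {a} {g} {s} {t} {k} {ρ} 1≤a ρ<a k<s t<s g+t≡sa =
  +-cancelʳ-< (j * a) (k * a + ρ) (g + k) (begin-strict
    k * a + ρ + j * a    <⟨ +-monoˡ-< (j * a) (+-monoʳ-< (k * a) ρ<a) ⟩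
    k * a + a + j * a    ≡⟨ regroup k j a ⟩
    (suc k + j) * a      ≡⟨ cong (_* a) s≡ ⟩
    s * a                ≡⟨ g+t≡sa ⟨
    g + t                ≤⟨ +-monoʳ-≤ g (<⇒≤pred (subst (t <_) (sym s≡) t<s)) ⟩
    g + (k + j)          ≡⟨ +-assoc g k j ⟨
    g + k + j            ≤⟨ +-monoʳ-≤ (g + k) (subst (_≤ j * a) (*-identityʳ j) (*-monoʳ-≤ j 1≤a)) ⟩
    g + k + j * a        ∎)
  where
  open ≤-Reasoning
  j = s ∸ suc k
  s≡ : suc k + j ≡ s
  s≡ = m+[n∸m]≡n k<s
  regroup : ∀ k j a → k * a + a + j * a ≡ (suc k + j) * a
  regroup = solve-∀

module _ {T : List ℕ} (pos : All (1 ≤_) T) {a} (a∈T : a ∈ T) (a-max : ∀ {x} → x ∈ T → x ≤ a) where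

  greedyRep-multiple : ∀ k ρ → greedyRep T (k * a + ρ) ≡ replicate k a ++ greedyRep T ρ
  greedyRep-multiple zero    ρ = refl
  greedyRep-multiple (suc k) ρ = begin
    greedyRep T (a + k * a + ρ)          ≡⟨ greedyRep-largest pos a-largest ⟩
    a ∷ greedyRep T (a + k * a + ρ ∸ a)  ≡⟨ cong (λ x → a ∷ greedyRep T (x ∸ a)) (+-assoc a (k * a) ρ) ⟩
    a ∷ greedyRep T (a + (k * a + ρ) ∸ a) ≡⟨ cong (λ x → a ∷ greedyRep T x) (m+n∸m≡n a (k * a + ρ)) ⟩
    a ∷ greedyRep T (k * a + ρ)          ≡⟨ cong (a ∷_) (greedyRep-multiple k ρ) ⟩
    a ∷ replicate k a ++ greedyRep T ρ   ∎
    where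
    open ≡-Reasoning
    a-largest : IsLargestBelow T (a + k * a + ρ) a
    a-largest = a∈T , ≤-trans (m≤m+n a (k * a)) (m≤m+n _ ρ) , λ x∈T _ → a-max x∈T

  greedy-multiple-length≤ : Greedy T → ∀ {m ys} k ρ → 1 ≤ m → m ≡ k * a + ρ → IsRep T m ys →
    k + length (greedyRep T ρ) ≤ length ys
  greedy-multiple-length≤ greedy k ρ 1≤m refl rep = subst (_≤ _) greedy-length (greedy _ 1≤m _ rep)
    where
    greedy-length : length (greedyRep T (k * a + ρ)) ≡ k + length (greedyRep T ρ)
    greedy-length = trans (cong length (greedyRep-multiple k ρ))
      (trans (length-++ (replicate k a)) (cong (_+ _) (length-replicate k)))

  exchange-shortens : 1 ∈ T → Greedy T → ∀ {g m} → Exchangeable a g → 1 ≤ g → g ≤ m →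
    Shortenable T m g
  exchange-shortens 1∈T greedy {g} {m} (s , t , t<s , g+t≡sa) 1≤g g≤m ys rep
    with division m a (All.lookup pos a∈T)
  ... | k , ρ , m≡ka+ρ , ρ<a
    with s ≤? k | greedy-multiple-length≤ greedy k ρ (≤-trans 1≤g g≤m) m≡ka+ρ rep
  ... | yes s≤k | k+ℓ≤ys = traded , (traded∈T , m+n≡o⇒n≡o∸m g+traded≡m) , traded-shorter
    where
    ρ-rep = greedyRep-isRep pos 1∈T ρ
    ℓ = length (greedyRep T ρ)
    traded = replicate t 1 ++ replicate (k ∸ s) a ++ greedyRep T ρ
    traded∈T = ++⁺ (replicate⁺ t 1∈T) (++⁺ (replicate⁺ (k ∸ s) a∈T) (proj₁ ρ-rep))
    g+traded≡m : g + sum traded ≡ m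
    g+traded≡m = begin
      g + sum traded               ≡⟨ cong (g +_) (sum-ones++copies t (k ∸ s) (greedyRep T ρ)) ⟩
      g + (t + ((k ∸ s) * a + sum (greedyRep T ρ)))
                                   ≡⟨ cong (λ x → g + (t + ((k ∸ s) * a + x))) (proj₂ ρ-rep) ⟩
      g + (t + ((k ∸ s) * a + ρ))  ≡⟨ traded-sum {g = g} {t = t} ρ g+t≡sa s≤k ⟩
      k * a + ρ                    ≡⟨ m≡ka+ρ ⟨
      m                            ∎
      where open ≡-Reasoning
    traded-shorter : length traded < length ys
    traded-shorter = begin-strict
      length traded      ≡⟨ length-replicate++replicate++ t (k ∸ s) (greedyRep T ρ) ⟩
      t + (k ∸ s + ℓ)    <⟨ +-monoˡ-< _ t<s ⟩
      s + (k ∸ s + ℓ)    ≡⟨ +-assoc s (k ∸ s) ℓ ⟨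
      s + (k ∸ s) + ℓ    ≡⟨ cong (_+ ℓ) (m+[n∸m]≡n s≤k) ⟩
      k + ℓ              ≤⟨ k+ℓ≤ys ⟩
      length ys          ∎
      where open ≤-Reasoning
  ... | no s≰k | k+ℓ≤ys = ones , (replicate⁺ (m ∸ g) 1∈T , ones-sum) , ones-shorter
    where
    ones = replicate (m ∸ g) 1
    ones-sum : sum ones ≡ m ∸ g
    ones-sum = trans (sum-replicate (m ∸ g) 1) (*-identityʳ (m ∸ g))
    m<g+k : m < g + k
    m<g+k = subst (_< g + k) (sym m≡ka+ρ)
      (k<s⇒amount<g+k (All.lookup pos a∈T) ρ<a (≰⇒> s≰k) t<s g+t≡sa)
    ones-shorter : length ones < length ys
    ones-shorter = begin-strict
      length ones  ≡⟨ length-replicate (m ∸ g) ⟩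
      m ∸ g        <⟨ +-cancelˡ-< g (m ∸ g) k (subst (_< g + k) (sym (m+[n∸m]≡n g≤m)) m<g+k) ⟩
      k            ≤⟨ m≤m+n k _ ⟩
      k + length (greedyRep T ρ) ≤⟨ k+ℓ≤ys ⟩
      length ys    ∎
      where open ≤-Reasoning

PairwiseExchangeable : List ℕ → Set
PairwiseExchangeable S = ∀ {a b} → a ∈ S → b ∈ S → a < b → Exchangeable a b

coins-below-greedy : ∀ {S m g ys} → IsLargestBelow S m g → g ∉ ys → IsRep S m ys → All (_< g) ys
coins-below-greedy (_ , _ , g-largest) g∉ys (coins∈S , sum≡) = All.tabulate λ {c} c∈ys →
  ≤∧≢⇒< (g-largest (All.lookup coins∈S c∈ys) (subst (c ≤_) sum≡ (∈⇒≤sum c∈ys)))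
        (λ { refl → g∉ys c∈ys })

positive-sum-below⇒1< : ∀ {g ys} → All (_< g) ys → All (1 ≤_) ys → 1 ≤ sum ys → 1 < g
positive-sum-below⇒1< (c<g ∷ _) (1≤c ∷ _) _ = <-≤-trans (s≤s 1≤c) c<g

module _ (S : List ℕ) (g : ℕ) where

  Below : List ℕ
  Below = filter (_<? g) S

  ∈Below⇒∈ : ∀ {x} → x ∈ Below → x ∈ S
  ∈Below⇒∈ = proj₁ ∘ ∈-filter⁻ (_<? g) {xs = S}

  ∈Below⇒< : ∀ {x} → x ∈ Below → x < g
  ∈Below⇒< = proj₂ ∘ ∈-filter⁻ (_<? g) {xs = S}

  ∈⇒∈Below : ∀ {x} → x ∈ S → x < g → x ∈ Below
  ∈⇒∈Below = ∈-filter⁺ (_<? g)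

IsRep-mono : ∀ {T S m zs} → (∀ {x} → x ∈ T → x ∈ S) → IsRep T m zs → IsRep S m zs
IsRep-mono T⊆S (zs∈T , sum≡) = All.map T⊆S zs∈T , sum≡

shortenable-by-smaller-coins : ∀ {S m g} → 1 ∈ S → All (1 ≤_) S → PairwiseExchangeable S →
  IsLargestBelow S m g → (1 < g → Greedy (Below S g)) → Shortenable S m g
shortenable-by-smaller-coins {S} {m} {g} 1∈S pos exch lg@(g∈S , g≤m , _) greedy-below
  ys rep@(coins∈S , sum≡) with g ∈? ys
... | yes g∈ys = removing-coin-shortens g∈ys rep
... | no g∉ys = map₂ (map₁ (IsRep-mono (∈Below⇒∈ S g)))
  (exchange-shortens posT a∈T a-max 1∈T (greedy-below 1<g) (exch (∈Below⇒∈ S g a∈T) g∈S a<g)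
    1≤g g≤m ys repT)
  where
  T = Below S g
  ys<g = coins-below-greedy lg g∉ys rep
  repT : IsRep T m ys
  repT = All.zipWith (λ (c∈S , c<g) → ∈⇒∈Below S g c∈S c<g) (coins∈S , ys<g) , sum≡
  1≤g = All.lookup pos g∈S
  1<g = positive-sum-below⇒1< ys<g (All.map (All.lookup pos) coins∈S)
          (subst (1 ≤_) (sym sum≡) (≤-trans 1≤g g≤m))
  posT = filter⁺ (_<? g) pos
  1∈T = ∈⇒∈Below S g 1∈S 1<g
  largest = largest-exists T g 1∈T 1≤g
  a = proj₁ largest
  a∈T = proj₁ (proj₂ largest)
  a<g = ∈Below⇒< S g a∈T
  a-max : ∀ {x} → x ∈ T → x ≤ a
  a-max x∈T = proj₂ (proj₂ (proj₂ largest)) x∈T (<⇒≤ (∈Below⇒< S g x∈T))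

greedy-bounded : ∀ N S → All (_< N) S → 1 ∈ S → All (1 ≤_) S → PairwiseExchangeable S → Greedy S
greedy-bounded zero    S bound 1∈S _   _    = contradiction (All.lookup bound 1∈S) n≮0
greedy-bounded (suc N) S bound 1∈S pos exch =
  greedy-by-shortening pos 1∈S λ {_} {g} lg@(g∈S , _) →
  shortenable-by-smaller-coins 1∈S pos exch lg λ 1<g →
    greedy-bounded N (Below S g)
      (All.tabulate λ x∈T → <-≤-trans (∈Below⇒< S g x∈T) (<⇒≤pred (All.lookup bound g∈S)))
      (∈⇒∈Below S g 1∈S 1<g) (filter⁺ (_<? g) pos)
      (λ a∈T b∈T → exch (∈Below⇒∈ S g a∈T) (∈Below⇒∈ S g b∈T))

pairwiseExchangeable⇒greedy : ∀ {S} → 1 ∈ S → All (1 ≤_) S → PairwiseExchangeable S → Greedy S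
pairwiseExchangeable⇒greedy {S} = greedy-bounded (suc (sum S)) S (All.tabulate (s≤s ∘ ∈⇒≤sum))

pairwiseExchangeable⇒completelyGreedy : ∀ {C} → CoinSet C → PairwiseExchangeable C → CompletelyGreedy C
pairwiseExchangeable⇒completelyGreedy (_ , pos) exch S (S⊆C , 1∈S) =
  pairwiseExchangeable⇒greedy 1∈S (All.tabulate (All.lookup pos ∘ S⊆C))
    (λ a∈S b∈S → exch (S⊆C a∈S) (S⊆C b∈S))

greedyTriples⇒pairwiseExchangeable : ∀ {C} → CoinSet C →
  (∀ S → SubCoinSet S C → AllPairs _≢_ S → length S ≡ 3 → Greedy S) → PairwiseExchangeable C
greedyTriples⇒pairwiseExchangeable {C} (1∈C , pos) greedy {a} {b} a∈C b∈C a<b with a ≟ 1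
... | yes refl = exchangeable-one (<⇒≤ a<b)
... | no a≢1 = greedy-triple⇒exchangeable 1≤a a<b
  (greedy (1 ∷ a ∷ b ∷ []) (triple⊆C , here refl) distinct refl)
  where
  1≤a = All.lookup pos a∈C
  1<a = ≤∧≢⇒< 1≤a (a≢1 ∘ sym)
  triple⊆C : ∀ {x} → x ∈ 1 ∷ a ∷ b ∷ [] → x ∈ C
  triple⊆C (here refl)                 = 1∈C
  triple⊆C (there (here refl))         = a∈C
  triple⊆C (there (there (here refl))) = b∈C
  distinct : AllPairs _≢_ (1 ∷ a ∷ b ∷ [])
  distinct = (<⇒≢ 1<a ∷ <⇒≢ (<-trans 1<a a<b) ∷ []) ∷ (<⇒≢ a<b ∷ []) ∷ [] ∷ []

head≡1 : ∀ {c cs} → CoinSet (c ∷ cs) → Linked _<_ (c ∷ cs) → c ≡ 1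
head≡1 (here c≡1 , _) _ = sym c≡1
head≡1 (there 1∈cs , 1≤c ∷ _) (c<d ∷ increasing) =
  contradiction 1≤c (<⇒≱ (All.lookup (Linked⇒All <-trans c<d increasing) 1∈cs))

coinAt-∈ : ∀ xs k → 1 ≤ k → k ≤ length xs → coinAt xs k ∈ xs
coinAt-∈ (x ∷ xs) 1             _ _         = here refl
coinAt-∈ (x ∷ xs) (suc (suc k)) _ (s≤s k<) = there (coinAt-∈ xs (suc k) (s≤s z≤n) k<)

linked-coinAt : ∀ {R : ℕ → ℕ → Set} xs →
  (∀ k → 2 ≤ k → k ≤ length xs → R (coinAt xs (k ∸ 1)) (coinAt xs k)) → Linked R xs
linked-coinAt []           _ = []
linked-coinAt (x ∷ [])     _ = [-]
linked-coinAt (x ∷ y ∷ ys) R-at = R-at 2 ≤-refl (s≤s (s≤s z≤n)) ∷ linked-coinAt (y ∷ ys) R-at′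
  where
  R-at′ : ∀ k → 2 ≤ k → k ≤ length (y ∷ ys) → _
  R-at′ (suc (suc k)) _ k≤ = R-at (3 + k) (s≤s (s≤s z≤n)) (s≤s k≤)
  R-at′ 1 (s≤s ()) _

allPairs⇒pairwise : ∀ {R : ℕ → ℕ → Set} {xs} → AllPairs (λ x y → x < y × R x y) xs →
  ∀ {a b} → a ∈ xs → b ∈ xs → a < b → R a b
allPairs⇒pairwise (_ ∷ _) (here refl) (here refl) a<a = contradiction a<a (<-irrefl refl)
allPairs⇒pairwise (a< ∷ _) (here refl) (there b∈xs) _ = proj₂ (All.lookup a< b∈xs)
allPairs⇒pairwise (b< ∷ _) (there a∈xs) (here refl) a<b =
  contradiction (proj₁ (All.lookup b< a∈xs)) (<-asym a<b)
allPairs⇒pairwise (_ ∷ pairs) (there a∈xs) (there b∈xs) a<b = allPairs⇒pairwise pairs a∈xs b∈xs a<b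

ConsecutiveTriplesGreedy : List ℕ → Set
ConsecutiveTriplesGreedy C =
  ∀ k → 3 ≤ k → k ≤ length C → Greedy (coinAt C 1 ∷ coinAt C (k ∸ 1) ∷ coinAt C k ∷ [])

completelyGreedy⇒consecutiveTriplesGreedy : ∀ {C} → CoinSet C → Linked _<_ C →
  CompletelyGreedy C → ConsecutiveTriplesGreedy C
completelyGreedy⇒consecutiveTriplesGreedy {[]} (() , _)
completelyGreedy⇒consecutiveTriplesGreedy {C@(_ ∷ _)} coinSet increasing cg k 3≤k k≤n =
  cg _ (triple⊆C , here (sym (head≡1 coinSet increasing)))
  where
  2≤k = <⇒≤ 3≤k
  1≤k = <⇒≤ 2≤k
  triple⊆C : ∀ {x} → x ∈ coinAt C 1 ∷ coinAt C (k ∸ 1) ∷ coinAt C k ∷ [] → x ∈ C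
  triple⊆C (here refl)                 = coinAt-∈ C 1 ≤-refl (≤-trans 1≤k k≤n)
  triple⊆C (there (here refl))         = coinAt-∈ C (k ∸ 1) (∸-monoˡ-≤ 1 2≤k) (≤-trans (m∸n≤m k 1) k≤n)
  triple⊆C (there (there (here refl))) = coinAt-∈ C k 1≤k k≤n

consecutiveTriplesGreedy⇒pairwiseExchangeable : ∀ {C} → CoinSet C → Linked _<_ C →
  ConsecutiveTriplesGreedy C → PairwiseExchangeable C
consecutiveTriplesGreedy⇒pairwiseExchangeable {[]} (() , _)
consecutiveTriplesGreedy⇒pairwiseExchangeable {c ∷ D} coinSet@(_ , pos) increasing greedy
  with head≡1 coinSet increasing
... | refl = allPairs⇒pairwise (Linked⇒AllPairs <×exchangeable-trans consecutive)
  where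
  C = 1 ∷ D
  exchangeable-at : ∀ k → 2 ≤ k → k ≤ length C →
    coinAt C (k ∸ 1) < coinAt C k → Exchangeable (coinAt C (k ∸ 1)) (coinAt C k)
  exchangeable-at 1 (s≤s ()) _ _
  exchangeable-at 2 _ _ 1<c₂ = exchangeable-one (<⇒≤ 1<c₂)
  exchangeable-at (suc (suc (suc k))) _ k≤n c<c′ =
    greedy-triple⇒exchangeable (All.lookup pos (coinAt-∈ C (2 + k) (s≤s z≤n) (<⇒≤ k≤n))) c<c′
      (greedy (3 + k) (s≤s (s≤s (s≤s z≤n))) k≤n)
  consecutive : Linked (λ a b → a < b × Exchangeable a b) C
  consecutive = Linked.zipWith (λ (a<b , exch) → a<b , exch a<b)
    (increasing , linked-coinAt {λ a b → a < b → Exchangeable a b} C exchangeable-at)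
  <×exchangeable-trans : ∀ {a b c} → a < b × Exchangeable a b → b < c × Exchangeable b c →
    a < c × Exchangeable a c
  <×exchangeable-trans (a<b , ab) (b<c , bc) = <-trans a<b b<c , exchangeable-trans ab bc

proposition4 : (C : List ℕ) → CoinSet C → Linked _<_ C
    → (CompletelyGreedy C ⇔ (∀ S → SubCoinSet S C → AllPairs _≢_ S → length S ≡ 3 → Greedy S))
    × (CompletelyGreedy C ⇔
        (∀ k → 3 ≤ k → k ≤ length C → Greedy (coinAt C 1 ∷ coinAt C (k ∸ 1) ∷ coinAt C k ∷ [])))
proposition4 C coinSet increasing =
  mk⇔ (λ cg S sub _ _ → cg S sub)
      (pairwiseExchangeable⇒completelyGreedy coinSet ∘ greedyTriples⇒pairwiseExchangeable coinSet) ,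
  mk⇔ (completelyGreedy⇒consecutiveTriplesGreedy coinSet increasing)
      (pairwiseExchangeable⇒completelyGreedy coinSet ∘
       consecutiveTriplesGreedy⇒pairwiseExchangeable coinSet increasing)
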